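{- Given an equation $\varepsilon$ in intentional form, the maps $\varphi\mapsto{\trianglelefteq_\varphi}$ and ${\trianglelefteq}\mapsto\varphi_\trianglelefteq$ are mutually inverse bijections between compatible surjections for $\varepsilon$ and compatible preorders for $\varepsilon$.
   Context: Write $x^{(0)}=x$, $x^{(m)}=x^{\ell^m}$, $x^{(-m)}=x^{r^m}$ for $m\in\mathbb{Z}^+$. $\varepsilon$ is $1\leq w_1\vee\cdots\vee w_k$ over $x_1,\ldots,x_n$, each $w_j$ a product of terms $x_i^{(m)}$. Terms are in the intentional language expanded by constants $+$ and $-$. $FS_\varepsilon$ is the set of final subwords of the $w_j$ (including $1$); for a variable $x$, $m\in\mathbb{N}$, $v\in FS_\varepsilon$: $\Delta^v_{x,m}=\{v\}\cup\bigcup_{j=0}^m\{\sigma_jx^{(j)}\cdots\sigma_mx^{(m)}v:\sigma_j,\ldots,\sigma_m\in\{ -1,0\},\sigma_0=0\}$, $\Delta^v_{x,-m}=\{v\}\cup\bigcup_{j=0}^m\{\sigma_jx^{(-j)}\cdots\sigma_mx^{(-m)}v:\sigma_j,\ldots,\sigma_m\in\{1,0\},\sigma_0=0\}$ ($\sigma=-1$: factor $-$; $\sigma=1$: factor $+$; $\sigma=0$: none); $S_\varepsilon=\{(i,m,v):v,x_i^{(m)}v\in FS_\varepsilon\}$; $\Delta_\varepsilon=\{1\}\cup\bigcup_{(i,m,v)\in S_\varepsilon}\Delta^v_{x_i,m}$ (finite). For a finite c-chain $(\Delta,\leq,\lessdot)$ ($\lessdot$ a subset of the covering relation) and an order-preserving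 partial function $g$: $(x,b)\in g^{[\ell]}$ iff $b\in Dom(g)$ and some $a\in Dom(g)$ has $a\lessdot b$, $g(a)<x\leq g(b)$; $(x,a)\in g^{[r]}$ iff $a\in Dom(g)$ and some $b\in Dom(g)$ has $a\lessdot b$, $g(a)\leq x<g(b)$; $g^{[m]}$ are the iterates ($g^{[0]}=g$, $g^{[k+1]}=(g^{[k]})^{[\ell]}$, $g^{[-(k+1)]}=(g^{[-k]})^{[r]}$). A compatible surjection for $\varepsilon$ is an onto map $\varphi:\Delta_\varepsilon\to\mathbb{N}_q=\{1,\ldots,q\}$ with: (i) each $g_i=\{(\varphi(u),\varphi(x_iu)):u,x_iu\in\Delta_\varepsilon\}$ is an order-preserving partial function; (ii) $\lessdot:=\{(\varphi(v),\varphi(+v)):v,+v\in\Delta_\varepsilon\}\cup\{(\varphi(-v),\varphi(v)):v,-v\in\Delta_\varepsilon\}$ is contained in the covering relation of $\mathbb{N}_q$; (iii) $\varphi(x_i^{(m)}u)=g_i^{[m]}(\varphi(u))$ whenever $u,x_i^{(m)}u\in\Delta_\varepsilon$, computed in $(\mathbb{N}_q,\leq,\lessdot)$. A compatible preorder is a total preorder $\trianglelefteq$ on $\Delta_\varepsilon$ ($u\triangleleft v$ meaning $u\trianglelefteq v$ and $v\not\trianglelefteq u$) such that: (i) if $u,v,x_iu,x_iv\in\Delta_\varepsilon$ and $u\trianglelefteq v$ then $x_iu\trianglelefteq x_iv$; (ii) if $u,-u\in\Delta_\varepsilon$ then $-u\triangleleft u$ and for all $v\in\Delta_\varepsilon$,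 $-u\triangleleft v$ implies $u\trianglelefteq v$; if $u,+u\in\Delta_\varepsilon$ then $u\triangleleft +u$ and for all $v$, $u\triangleleft v$ implies $+u\trianglelefteq v$; (iii$\ell$) if $j\in\mathbb{Z}^+$ and $v,x_i^{(j)}v\in\Delta_\varepsilon$ then $-x_i^{(j)}v$, $x_i^{(j-1)}{ - }x_i^{(j)}v$, $x_i^{(j-1)}x_i^{(j)}v\in\Delta_\varepsilon$ and $x_i^{(j-1)}{ - }x_i^{(j)}v\triangleleft v\trianglelefteq x_i^{(j-1)}x_i^{(j)}v$; (iii$r$) if $j\in\mathbb{Z}^-$ and $v,x_i^{(j)}v\in\Delta_\varepsilon$ then $+x_i^{(j)}v$, $x_i^{(j+1)}{+}x_i^{(j)}v$, $x_i^{(j+1)}x_i^{(j)}v\in\Delta_\varepsilon$ and $x_i^{(j+1)}x_i^{(j)}v\trianglelefteq v\triangleleft x_i^{(j+1)}{+}x_i^{(j)}v$. For an onto map $\varphi$ from $\Delta_\varepsilon$ to an initial segment of $\mathbb{Z}^+$, $u\trianglelefteq_\varphi v$ iff $\varphi(u)\leq\varphi(v)$. For a total preorder $\trianglelefteq$, $\varphi_\trianglelefteq$ is the quotient map of $\Delta_\varepsilon$ by ${\equiv}={\trianglelefteq}\cap{\trianglelefteq}^{ -1}$ followed by the unique isomorphism of the finite chain $(\Delta_\varepsilon/{\equiv},\trianglelefteq_\equiv)$ with an initial segment $\mathbb{N}_q$ of $\mathbb{Z}^+$. -}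

module Defs where

open import Data.Nat using (ℕ; zero; suc; _≤_; _<_; _∸_; _≤ᵇ_)
open import Data.Integer as ℤ using (ℤ; +_; -[1+_])
open import Data.Bool using (Bool; true; false; T; _∧_; not)
open import Data.List using (List; []; _∷_; _++_; map; concatMap; tails; upTo; filterᵇ; length)
open import Data.List.Membership.Propositional using (_∈_)
open import Data.Product using (Σ; _×_; _,_; ∃)
open import Data.Sum using (_⊎_)
open import Relation.Nullary using (¬_)
open import Relation.Binary.PropositionalEquality using (_≡_)

-- A letter is x_i^{(m)} (variable index i, exponent m ∈ ℤ), or + or -.
data Letter : Set where
  var   : ℕ → ℤ → Letter
  plus  : Letter
  minus : Letter

-- A word (product of letters); the empty word is 1.  x u  is  x ∷ u.
Word : Set
Word = List Letter

VarTerm : Set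
VarTerm = ℕ × ℤ

embed : List VarTerm → Word
embed = map (λ { (i , m) → var i m })

-- An equation  1 ≤ w_1 ∨ … ∨ w_k  in intentional form: the list w_1 … w_k,
-- each w_j a product of terms x_i^{(m)}.
Equation : Set
Equation = List (List VarTerm)

FS : Equation → List Word
FS ε = [] ∷ concatMap (λ w → tails (embed w)) ε

-- block e σ i j len v : all words  σ_j x^{(e j)} σ_{j+1} x^{(e (j+1))} … σ_{j+len} x^{(e (j+len))} v
-- with each σ either absent or the constant σ.
block : (ℕ → ℤ) → Letter → ℕ → ℕ → ℕ → Word → List Word
block e s i j zero v = (var i (e j) ∷ v) ∷ (s ∷ var i (e j) ∷ v) ∷ []
block e s i j (suc len) v =
  concatMap (λ w → (var i (e j) ∷ w) ∷ (s ∷ var i (e j) ∷ w) ∷ [])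
            (block e s i (suc j) len v)

-- words with j = 0 (σ_0 = 0) up to bound b
block0 : (ℕ → ℤ) → Letter → ℕ → ℕ → Word → List Word
block0 e s i zero v = (var i (e 0) ∷ v) ∷ []
block0 e s i (suc b) v = map (λ w → var i (e 0) ∷ w) (block e s i 1 b v)

-- {v} ∪ ⋃_{j=0}^{b} {σ_j x^{(e j)} ⋯ σ_b x^{(e b)} v}
Δgen : (ℕ → ℤ) → Letter → ℕ → ℕ → Word → List Word
Δgen e s i b v =
  v ∷ (block0 e s i b v ++ concatMap (λ j → block e s i j (b ∸ j) v) (map suc (upTo b)))

negℕ : ℕ → ℤ
negℕ j = ℤ.- (+ j)

Δxv : ℕ → ℤ → Word → List Word
Δxv i (+ m)      v = Δgen +_   minus i m v
Δxv i (-[1+ m ]) v = Δgen negℕ plus i (suc m) v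

-- Δ_ε = {1} ∪ ⋃_{(i,m,v) ∈ S_ε} Δ^v_{x_i,m}; the triples (i,m,v) of S_ε
-- are read off the final subwords of the form x_i^{(m)} v (then v ∈ FS_ε too).
Δ : Equation → List Word
Δ ε = [] ∷ concatMap f (FS ε)
  where
  f : Word → List Word
  f (var i m ∷ v) = Δxv i m v
  f _             = []

Rel : Set₁
Rel = ℕ → ℕ → Set

IsOPPF : Rel → Set
IsOPPF G = (∀ a b b′ → G a b → G a b′ → b ≡ b′)
         × (∀ a a′ b b′ → G a b → G a′ b′ → a ≤ a′ → b ≤ b′)

liftℓ : Rel → Rel → Rel
liftℓ Cov G x b = Σ ℕ λ a → Σ ℕ λ ga → Σ ℕ λ gb →
  Cov a b × G a ga × G b gb × ga < x × x ≤ gb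

liftr : Rel → Rel → Rel
liftr Cov G x a = Σ ℕ λ b → Σ ℕ λ ga → Σ ℕ λ gb →
  Cov a b × G a ga × G b gb × ga ≤ x × x < gb

iterℓ : Rel → Rel → ℕ → Rel
iterℓ Cov G zero = G
iterℓ Cov G (suc k) = liftℓ Cov (iterℓ Cov G k)

iterr : Rel → Rel → ℕ → Rel
iterr Cov G zero = G
iterr Cov G (suc k) = liftr Cov (iterr Cov G k)

iter : Rel → Rel → ℤ → Rel
iter Cov G (+ k)      = iterℓ Cov G k
iter Cov G (-[1+ k ]) = iterr Cov G (suc k)

-- Compatible surjections  φ : Δ_ε → ℕ_q  (φ given as a map on words; only its
-- values on Δ_ε matter)

module _ (ε : Equation) (q : ℕ) (φ : Word → ℕ) where

  gRel : ℕ → Rel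
  gRel i a b = Σ Word λ u → u ∈ Δ ε × (var i (+ 0) ∷ u) ∈ Δ ε
                          × φ u ≡ a × φ (var i (+ 0) ∷ u) ≡ b

  covRel : Rel
  covRel a b =
      (Σ Word λ v → v ∈ Δ ε × (plus ∷ v) ∈ Δ ε × φ v ≡ a × φ (plus ∷ v) ≡ b)
    ⊎ (Σ Word λ v → v ∈ Δ ε × (minus ∷ v) ∈ Δ ε × φ (minus ∷ v) ≡ a × φ v ≡ b)

  IsOnto : Set
  IsOnto = (∀ u → u ∈ Δ ε → 1 ≤ φ u × φ u ≤ q)
         × (∀ k → 1 ≤ k → k ≤ q → Σ Word λ u → u ∈ Δ ε × φ u ≡ k)

  CompatSurj : Set
  CompatSurj =
      IsOnto
    × (∀ i → IsOPPF (gRel i))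
    × (∀ a b → covRel a b → b ≡ suc a)
    × (∀ i m u → u ∈ Δ ε → (var i m ∷ u) ∈ Δ ε →
         iter covRel (gRel i) m (φ u) (φ (var i m ∷ u)))

-- Compatible preorders (a relation on Δ_ε, given as a Bool-valued relation
-- on words; only its values on Δ_ε matter)

module _ (ε : Equation) (R : Word → Word → Bool) where

  _⊴_ : Word → Word → Set
  u ⊴ v = T (R u v)

  _◁_ : Word → Word → Set
  u ◁ v = u ⊴ v × ¬ (v ⊴ u)

  IsTotalPreorder : Set
  IsTotalPreorder =
      (∀ u v → u ∈ Δ ε → v ∈ Δ ε → u ⊴ v ⊎ v ⊴ u)
    × (∀ u v w → u ∈ Δ ε → v ∈ Δ ε → w ∈ Δ ε → u ⊴ v → v ⊴ w → u ⊴ w)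

  CompatPre : Set
  CompatPre =
      IsTotalPreorder
    × (∀ i u v → u ∈ Δ ε → v ∈ Δ ε → (var i (+ 0) ∷ u) ∈ Δ ε → (var i (+ 0) ∷ v) ∈ Δ ε →
         u ⊴ v → (var i (+ 0) ∷ u) ⊴ (var i (+ 0) ∷ v))
    × (∀ u → u ∈ Δ ε → (minus ∷ u) ∈ Δ ε →
         (minus ∷ u) ◁ u × (∀ v → v ∈ Δ ε → (minus ∷ u) ◁ v → u ⊴ v))
    × (∀ u → u ∈ Δ ε → (plus ∷ u) ∈ Δ ε →
         u ◁ (plus ∷ u) × (∀ v → v ∈ Δ ε → u ◁ v → (plus ∷ u) ⊴ v))
    × (∀ i j v → j ℤ.> ℤ.0ℤ → v ∈ Δ ε → (var i j ∷ v) ∈ Δ ε →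
         (minus ∷ var i j ∷ v) ∈ Δ ε
         × (var i (j ℤ.- ℤ.1ℤ) ∷ minus ∷ var i j ∷ v) ∈ Δ ε
         × (var i (j ℤ.- ℤ.1ℤ) ∷ var i j ∷ v) ∈ Δ ε
         × (var i (j ℤ.- ℤ.1ℤ) ∷ minus ∷ var i j ∷ v) ◁ v
         × v ⊴ (var i (j ℤ.- ℤ.1ℤ) ∷ var i j ∷ v))
    × (∀ i j v → j ℤ.< ℤ.0ℤ → v ∈ Δ ε → (var i j ∷ v) ∈ Δ ε →
         (plus ∷ var i j ∷ v) ∈ Δ ε
         × (var i (j ℤ.+ ℤ.1ℤ) ∷ plus ∷ var i j ∷ v) ∈ Δ ε
         × (var i (j ℤ.+ ℤ.1ℤ) ∷ var i j ∷ v) ∈ Δ ε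
         × (var i (j ℤ.+ ℤ.1ℤ) ∷ var i j ∷ v) ⊴ v
         × v ◁ (var i (j ℤ.+ ℤ.1ℤ) ∷ plus ∷ var i j ∷ v))

preOf : (Word → ℕ) → Word → Word → Bool
preOf φ u v = φ u ≤ᵇ φ v

reps : (Word → Word → Bool) → List Word → List Word
reps R [] = []
reps R (w ∷ ws) = w ∷ filterᵇ (λ w′ → not (R w w′ ∧ R w′ w)) (reps R ws)

qOf : Equation → (Word → Word → Bool) → ℕ
qOf ε R = length (reps R (Δ ε))

-- φ_⊴ : quotient map followed by the isomorphism (Δ_ε/≡ , ⊴_≡) ≅ ℕ_q,
-- i.e. u ↦ the number of ≡-classes [w] with w ⊴ u
φOf : Equation → (Word → Word → Bool) → Word → ℕ
φOf ε R u = length (filterᵇ (λ w → R w u) (reps R (Δ ε)))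

-- A surjection φ of Δ_ε onto an initial segment of ℕ is determined by the preorder it
-- induces: counting the ≡-classes below u gives back φ u, because two such surjections
-- inducing the same preorder agree (induction on the value). The compatibility conditions
-- then match up one by one. A pair is a covering pair of ℕ_q exactly when it is an
-- immediate-successor pair of the preorder, which is (ii) on both sides. For (iii), Δ_ε
-- contains with every x^(j) v (j > 0) the words −x^(j) v, x^(j−1) −x^(j) v and
-- x^(j−1) x^(j) v (dually for j < 0); these are precisely the witnesses evaluating the lift
-- g^[j] at φ v, and they are unique since lifts of order-preserving partial functions along
-- covering pairs are again order-preserving partial functions.
module Submission where

open import Defs
open import Data.Nat using (ℕ; zero; suc; _≤_; _<_; _∸_; z≤n; s≤s; _≟_)
open import Data.Nat.Properties
  using ( ≤-refl; ≤-trans; ≤-<-trans; <-≤-trans; <-trans; ≤-antisym; ≤-reflexive; ≤-total; <-irrefl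
        ; <⇒≤; <⇒≱; ≰⇒>; ≮⇒≥; n≤1+n; n<1+n; m≤n⇒m≤1+n; 1+n≰n; suc-injective; n∸n≡0; +-∸-assoc
        ; ≤⇒≤ᵇ; ≤ᵇ⇒≤ )
open import Data.Integer as ℤ using (ℤ; +_; -[1+_])
open import Data.Bool using (Bool; true; false; T; not; _∧_)
open import Data.Bool.Properties using (T?; T-∧; T-not-≡)
open import Data.Unit using (tt)
open import Data.Empty using (⊥-elim)
open import Data.List using (List; []; _∷_; _++_; map; concatMap; tails; upTo; length; filter; filterᵇ)
open import Data.List.Properties
  using (length-map; length-upTo; length-filter; filter-notAll; filter-some; ∷-injectiveˡ)
open import Data.List.Membership.Propositional using (_∈_; find; lose)
open import Data.List.Membership.Propositional.Properties
  using ( ∈-concatMap⁺; ∈-concatMap⁻; ∈-map⁺; ∈-map⁻; ∈-++⁺ˡ; ∈-++⁺ʳ; ∈-++⁻; ∈-upTo⁺; ∈-upTo⁻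
        ; ∈-filter⁺; ∈-filter⁻ )
open import Data.List.Membership.DecPropositional _≟_ using (_∈?_)
open import Data.List.Relation.Binary.Subset.Propositional using (_⊆_)
open import Data.List.Relation.Unary.Any as Any using (here; there)
open import Data.List.Relation.Unary.All as All using (All)
open import Data.List.Relation.Unary.AllPairs using (AllPairs; []; _∷_)
import Data.List.Relation.Unary.AllPairs.Properties as AllPairs
open import Data.List.Relation.Unary.Unique.Propositional using (Unique)
open import Data.Product as Product using (∃; _×_; _,_; proj₁; proj₂)
open import Data.Sum as Sum using (_⊎_; inj₁; inj₂)
open import Function using (_∘_; id)
open import Function.Bundles using (Equivalence; _⇔_; mk⇔)
open import Relation.Nullary using (¬_; yes; no; ¬?; contradiction; _×-dec_)
open import Relation.Binary.PropositionalEquality using (_≡_; _≢_; refl; sym; trans; subst; subst₂)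

unique-⊆⇒length≤ : ∀ {xs ys : List ℕ} → Unique xs → xs ⊆ ys → length xs ≤ length ys
unique-⊆⇒length≤ {[]} _ _ = z≤n
unique-⊆⇒length≤ {x ∷ xs} {ys} (x∉xs ∷ uniq) x∷xs⊆ys =
  ≤-trans (s≤s (unique-⊆⇒length≤ uniq xs⊆ys∖x))
          (filter-notAll (λ y → ¬? (y ≟ x)) ys (Any.map (λ x≡y y≢x → y≢x (sym x≡y)) (x∷xs⊆ys (here refl))))
  where
  xs⊆ys∖x : xs ⊆ filter (λ y → ¬? (y ≟ x)) ys
  xs⊆ys∖x y∈xs = ∈-filter⁺ _ (x∷xs⊆ys (there y∈xs)) (λ y≡x → All.lookup x∉xs y∈xs (sym y≡x))

∈-oneTo : ∀ {n x} → 1 ≤ x → x ≤ n → x ∈ map suc (upTo n)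
∈-oneTo {x = suc y} _ y<n = ∈-map⁺ suc (∈-upTo⁺ y<n)

unique-bounded⇒onto : ∀ {n xs} → Unique xs → length xs ≡ n → (∀ {x} → x ∈ xs → 1 ≤ x × x ≤ n) →
                      ∀ {k} → 1 ≤ k → k ≤ n → k ∈ xs
unique-bounded⇒onto {n} {xs} uniq |xs|≡n bounded {k} 1≤k k≤n with k ∈? xs
... | yes k∈xs = k∈xs
... | no  k∉xs = contradiction (≤-<-trans (unique-⊆⇒length≤ uniq xs⊆oneTo∖k) oneTo∖k<n) (<-irrefl |xs|≡n)
  where
  oneTo∖k : List ℕ
  oneTo∖k = filter (λ y → ¬? (y ≟ k)) (map suc (upTo n))
  xs⊆oneTo∖k : xs ⊆ oneTo∖k
  xs⊆oneTo∖k {x} x∈xs = ∈-filter⁺ _ (∈-oneTo (proj₁ (bounded x∈xs)) (proj₂ (bounded x∈xs)))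
                                     (λ x≡k → k∉xs (subst (_∈ xs) x≡k x∈xs))
  oneTo∖k<n : length oneTo∖k < n
  oneTo∖k<n = subst (length oneTo∖k <_) (trans (length-map suc (upTo n)) (length-upTo n))
    (filter-notAll _ (map suc (upTo n)) (Any.map (λ k≡y y≢k → y≢k (sym k≡y)) (∈-oneTo 1≤k k≤n)))

module _ {A : Set} (p q : A → Bool) where

  length-filterᵇ-mono : ∀ xs → (∀ {x} → x ∈ xs → T (p x) → T (q x)) →
                        length (filterᵇ p xs) ≤ length (filterᵇ q xs)
  length-filterᵇ-mono []       _   = z≤n
  length-filterᵇ-mono (x ∷ xs) p⇒q with p x in px | q x in qx
  ... | true  | true  = s≤s (length-filterᵇ-mono xs (p⇒q ∘ there))
  ... | true  | false = contradiction (p⇒q (here refl) (subst T (sym px) tt)) (subst T qx)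
  ... | false | true  = m≤n⇒m≤1+n (length-filterᵇ-mono xs (p⇒q ∘ there))
  ... | false | false = length-filterᵇ-mono xs (p⇒q ∘ there)

  length-filterᵇ-mono-< : ∀ xs → (∀ {x} → x ∈ xs → T (p x) → T (q x)) →
                          ∀ {y} → y ∈ xs → T (q y) → ¬ T (p y) →
                          length (filterᵇ p xs) < length (filterᵇ q xs)
  length-filterᵇ-mono-< (x ∷ xs) p⇒q (here refl) qy ¬py with p x | q x
  ... | true  | _     = contradiction tt ¬py
  ... | false | true  = s≤s (length-filterᵇ-mono xs (p⇒q ∘ there))
  ... | false | false = ⊥-elim qy
  length-filterᵇ-mono-< (x ∷ xs) p⇒q (there y∈xs) qy ¬py with p x in px | q x in qx
  ... | true  | true  = s≤s (length-filterᵇ-mono-< xs (p⇒q ∘ there) y∈xs qy ¬py)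
  ... | true  | false = contradiction (p⇒q (here refl) (subst T (sym px) tt)) (subst T qx)
  ... | false | true  = m≤n⇒m≤1+n (length-filterᵇ-mono-< xs (p⇒q ∘ there) y∈xs qy ¬py)
  ... | false | false = length-filterᵇ-mono-< xs (p⇒q ∘ there) y∈xs qy ¬py

T-injective : ∀ {a b} → (T a → T b) → (T b → T a) → a ≡ b
T-injective {true}  {true}  _   _   = refl
T-injective {true}  {false} a⇒b _   = ⊥-elim (a⇒b tt)
T-injective {false} {true}  _   b⇒a = ⊥-elim (b⇒a tt)
T-injective {false} {false} _   _   = refl

OntoSegment : List Word → ℕ → (Word → ℕ) → Set
OntoSegment L q f = (∀ u → u ∈ L → 1 ≤ f u × f u ≤ q)
                  × (∀ k → 1 ≤ k → k ≤ q → ∃ λ u → u ∈ L × f u ≡ k)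

-- Induction on f u: a word w with f w = f u − 1 lies strictly below u for g.
onto-segment-≤ : ∀ {L p q f g} → OntoSegment L p f → OntoSegment L q g →
                 (∀ {u v} → u ∈ L → v ∈ L → g u ≤ g v → f u ≤ f v) → ∀ {u} → u ∈ L → f u ≤ g u
onto-segment-≤ {L} {p} {q} {f} {g} f-onto g-onto g≤⇒f≤ u∈L = go _ u∈L refl
  where
  go : ∀ k {u} → u ∈ L → f u ≡ k → k ≤ g u
  go zero          _   _   = z≤n
  go (suc zero)    u∈L _   = proj₁ (proj₁ g-onto _ u∈L)
  go (suc (suc k)) {u} u∈L fu≡ =
    let w , w∈L , fw≡ = proj₂ f-onto (suc k) (s≤s z≤n)
                          (≤-trans (n≤1+n _) (subst (_≤ p) fu≡ (proj₂ (proj₁ f-onto u u∈L))))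
    in ≤-trans (s≤s (go (suc k) w∈L fw≡))
               (≰⇒> λ gu≤gw → 1+n≰n (subst₂ _≤_ fu≡ fw≡ (g≤⇒f≤ u∈L w∈L gu≤gw)))

onto-segment-unique : ∀ {L p q f g u₀} → u₀ ∈ L → OntoSegment L p f → OntoSegment L q g →
                      (∀ {u v} → u ∈ L → v ∈ L → f u ≤ f v ⇔ g u ≤ g v) →
                      p ≡ q × (∀ {u} → u ∈ L → f u ≡ g u)
onto-segment-unique {L} {f = f} {g} {u₀} u₀∈L f-onto g-onto f⇔g =
  ≤-antisym (top-≤ f-onto g-onto f≡g) (top-≤ g-onto f-onto (sym ∘ f≡g)) , f≡g
  where
  f≡g : ∀ {u} → u ∈ L → f u ≡ g u
  f≡g u∈L = ≤-antisym (onto-segment-≤ f-onto g-onto (λ u∈ v∈ → Equivalence.from (f⇔g u∈ v∈)) u∈L)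
                      (onto-segment-≤ g-onto f-onto (λ u∈ v∈ → Equivalence.to (f⇔g u∈ v∈)) u∈L)
  top-≤ : ∀ {p q f g} → OntoSegment L p f → OntoSegment L q g → (∀ {u} → u ∈ L → f u ≡ g u) → p ≤ q
  top-≤ {p} {q} {f} {g} f-onto g-onto f≡g
    with u₀-bounds ← proj₁ f-onto u₀ u₀∈L
    with w , w∈L , fw≡p ← proj₂ f-onto p (≤-trans (proj₁ u₀-bounds) (proj₂ u₀-bounds)) ≤-refl
    = subst (_≤ q) (trans (sym (f≡g w∈L)) fw≡p) (proj₂ (proj₁ g-onto w w∈L))

TotalPreorderOn : List Word → (Word → Word → Bool) → Set
TotalPreorderOn L R =
    (∀ u v → u ∈ L → v ∈ L → T (R u v) ⊎ T (R v u))
  × (∀ u v w → u ∈ L → v ∈ L → w ∈ L → T (R u v) → T (R v w) → T (R u w))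

-- rank u counts the ≡-classes below u; for L = Δ ε, rank and size are φOf ε R and qOf ε R.
module Ranking (L : List Word) (R : Word → Word → Bool) (preorder : TotalPreorderOn L R) where

  private
    _≲_ _≈_ _≺_ : Word → Word → Set
    u ≲ v = T (R u v)
    u ≈ v = u ≲ v × v ≲ u
    u ≺ v = u ≲ v × ¬ (v ≲ u)

    total : ∀ u v → u ∈ L → v ∈ L → u ≲ v ⊎ v ≲ u
    total = proj₁ preorder

    ≲-trans : ∀ u v w → u ∈ L → v ∈ L → w ∈ L → u ≲ v → v ≲ w → u ≲ w
    ≲-trans = proj₂ preorder

    ≲-refl : ∀ {u} → u ∈ L → u ≲ u
    ≲-refl {u} u∈L with total u u u∈L u∈L
    ... | inj₁ u≲u = u≲u
    ... | inj₂ u≲u = u≲u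

    keep : Word → Word → Bool
    keep x w = not (R x w ∧ R w x)

    keep⁺ : ∀ {x w} → ¬ (x ≈ w) → T (keep x w)
    keep⁺ {x} {w} x≉w with R x w ∧ R w x in eq
    ... | true  = x≉w (Equivalence.to T-∧ (subst T (sym eq) tt))
    ... | false = tt

    keep⁻ : ∀ {x w} → T (keep x w) → ¬ (x ≈ w)
    keep⁻ kept x≈w = subst T (Equivalence.to T-not-≡ kept) (Equivalence.from T-∧ x≈w)

  reps-⊆ : ∀ xs → reps R xs ⊆ xs
  reps-⊆ (x ∷ xs) (here refl) = here refl
  reps-⊆ (x ∷ xs) (there w∈) = there (reps-⊆ xs (proj₁ (∈-filter⁻ (T? ∘ keep x) w∈)))

  reps-cover : ∀ xs → xs ⊆ L → ∀ {u} → u ∈ xs → ∃ λ w → w ∈ reps R xs × w ≈ u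
  reps-cover (x ∷ xs) xs⊆L (here refl) = x , here refl , ≲-refl x∈L , ≲-refl x∈L
    where
    x∈L : x ∈ L
    x∈L = xs⊆L (here refl)
  reps-cover (x ∷ xs) xs⊆L {u} (there u∈xs) with reps-cover xs (xs⊆L ∘ there) u∈xs
  ... | w , w∈reps , w≲u , u≲w with T? (R x w) ×-dec T? (R w x)
  ... | yes (x≲w , w≲x) =
    x , here refl , ≲-trans _ _ _ x∈L w∈L u∈L x≲w w≲u , ≲-trans _ _ _ u∈L w∈L x∈L u≲w w≲x
    where
    x∈L : x ∈ L
    x∈L = xs⊆L (here refl)
    w∈L : w ∈ L
    w∈L = xs⊆L (there (reps-⊆ xs w∈reps))
    u∈L : u ∈ L
    u∈L = xs⊆L (there u∈xs)
  ... | no x≉w = w , there (∈-filter⁺ (T? ∘ keep x) w∈reps (keep⁺ x≉w)) , w≲u , u≲w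

  rank : Word → ℕ
  rank u = length (filterᵇ (λ w → R w u) (reps R L))

  size : ℕ
  size = length (reps R L)

  rank-mono : ∀ {u v} → u ∈ L → v ∈ L → u ≲ v → rank u ≤ rank v
  rank-mono u∈L v∈L u≲v = length-filterᵇ-mono _ _ (reps R L)
    (λ w∈reps w≲u → ≲-trans _ _ _ (reps-⊆ L w∈reps) u∈L v∈L w≲u u≲v)

  rank-< : ∀ {u v} → u ∈ L → v ∈ L → ¬ (u ≲ v) → rank v < rank u
  rank-< {u} {v} u∈L v∈L u≴v with total u v u∈L v∈L | reps-cover L id u∈L
  ... | inj₁ u≲v | _ = contradiction u≲v u≴v
  ... | inj₂ v≲u | w , w∈reps , w≲u , u≲w =
    length-filterᵇ-mono-< _ _ (reps R L)
      (λ w′∈reps w′≲v → ≲-trans _ _ _ (reps-⊆ L w′∈reps) v∈L u∈L w′≲v v≲u)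
      w∈reps w≲u (λ w≲v → u≴v (≲-trans _ _ _ u∈L (reps-⊆ L w∈reps) v∈L u≲w w≲v))

  rank-reflects : ∀ {u v} → u ∈ L → v ∈ L → rank u ≤ rank v → u ≲ v
  rank-reflects {u} {v} u∈L v∈L ru≤rv with T? (R u v)
  ... | yes u≲v = u≲v
  ... | no  u≴v = contradiction ru≤rv (<⇒≱ (rank-< u∈L v∈L u≴v))

  reps-rank-distinct : ∀ xs → xs ⊆ L → AllPairs (λ a b → rank a ≢ rank b) (reps R xs)
  reps-rank-distinct [] _ = []
  reps-rank-distinct (x ∷ xs) xs⊆L =
    All.tabulate head-distinct ∷ AllPairs.filter⁺ (T? ∘ keep x) (reps-rank-distinct xs (xs⊆L ∘ there))
    where
    head-distinct : ∀ {y} → y ∈ filterᵇ (keep x) (reps R xs) → rank x ≢ rank y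
    head-distinct {y} y∈ rx≡ry with ∈-filter⁻ (T? ∘ keep x) y∈
    ... | y∈reps , kept = keep⁻ kept (rank-reflects x∈L y∈L (≤-reflexive rx≡ry) ,
                                      rank-reflects y∈L x∈L (≤-reflexive (sym rx≡ry)))
      where
      x∈L : x ∈ L
      x∈L = xs⊆L (here refl)
      y∈L : y ∈ L
      y∈L = xs⊆L (there (reps-⊆ xs y∈reps))

  rank-onto : OntoSegment L size rank
  rank-onto = bounds , onto
    where
    bounds : ∀ u → u ∈ L → 1 ≤ rank u × rank u ≤ size
    bounds u u∈L =
      let w , w∈reps , w≲u , _ = reps-cover L id u∈L
      in filter-some (T? ∘ λ w → R w u) (lose w∈reps w≲u) , length-filter _ (reps R L)

    bounded : ∀ {x} → x ∈ map rank (reps R L) → 1 ≤ x × x ≤ size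
    bounded x∈ with w , w∈reps , refl ← ∈-map⁻ rank x∈ = bounds w (reps-⊆ L w∈reps)

    onto : ∀ k → 1 ≤ k → k ≤ size → ∃ λ u → u ∈ L × rank u ≡ k
    onto k 1≤k k≤size =
      let w , w∈reps , k≡rw = ∈-map⁻ rank (unique-bounded⇒onto (AllPairs.map⁺ (reps-rank-distinct L id))
                                             (length-map rank (reps R L)) bounded 1≤k k≤size)
      in w , reps-⊆ L w∈reps , sym k≡rw

  -- Some w has rank (rank a + 1) by surjectivity; then a ≺ w, hence b ≲ w.
  rank-succ : ∀ {a b} → a ∈ L → b ∈ L → a ≺ b → (∀ v → v ∈ L → a ≺ v → b ≲ v) → rank b ≡ suc (rank a)
  rank-succ {a} {b} a∈L b∈L (_ , b⋠a) least =
    let ra<rb : rank a < rank b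
        ra<rb = rank-< b∈L a∈L b⋠a
        w , w∈L , rw≡ = proj₂ rank-onto (suc (rank a)) (s≤s z≤n) (≤-trans ra<rb (proj₂ (proj₁ rank-onto b b∈L)))
        a≺w : a ≺ w
        a≺w = rank-reflects a∈L w∈L (subst (rank a ≤_) (sym rw≡) (n≤1+n (rank a))) ,
              λ w≲a → <⇒≱ (subst (rank a <_) (sym rw≡) ≤-refl) (rank-mono w∈L a∈L w≲a)
    in ≤-antisym (subst (rank b ≤_) rw≡ (rank-mono b∈L w∈L (least w w∈L a≺w))) ra<rb

  preOf-rank : ∀ {u v} → u ∈ L → v ∈ L → preOf rank u v ≡ R u v
  preOf-rank u∈L v∈L = T-injective (rank-reflects u∈L v∈L ∘ ≤ᵇ⇒≤ _ _) (≤⇒≤ᵇ ∘ rank-mono u∈L v∈L)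

module _ (φ : Word → ℕ) where

  preOf-totalPreorder : ∀ L → TotalPreorderOn L (preOf φ)
  preOf-totalPreorder L =
    (λ u v _ _ → Sum.map ≤⇒≤ᵇ ≤⇒≤ᵇ (≤-total (φ u) (φ v))) ,
    (λ u v w _ _ _ u≤v v≤w → ≤⇒≤ᵇ (≤-trans (≤ᵇ⇒≤ (φ u) (φ v) u≤v) (≤ᵇ⇒≤ (φ v) (φ w) v≤w)))

  <⇒preOf-strict : ∀ {u v} → φ u < φ v → T (preOf φ u v) × ¬ T (preOf φ v u)
  <⇒preOf-strict φu<φv = ≤⇒≤ᵇ (<⇒≤ φu<φv) , λ v≤u → <⇒≱ φu<φv (≤ᵇ⇒≤ _ _ v≤u)

  preOf-strict⇒< : ∀ {u v} → T (preOf φ u v) × ¬ T (preOf φ v u) → φ u < φ v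
  preOf-strict⇒< (_ , v≰u) = ≰⇒> (v≰u ∘ ≤⇒≤ᵇ)

  suc⇒preOf-cover : ∀ {a b} → φ b ≡ suc (φ a) →
                    (T (preOf φ a b) × ¬ T (preOf φ b a))
                  × (∀ v → T (preOf φ a v) × ¬ T (preOf φ v a) → T (preOf φ b v))
  suc⇒preOf-cover φb≡ = <⇒preOf-strict (≤-reflexive (sym φb≡)) ,
                        λ v a◁v → ≤⇒≤ᵇ (subst (_≤ φ v) (sym φb≡) (preOf-strict⇒< a◁v))

rank-preOf : ∀ {L q φ u₀} → u₀ ∈ L → OntoSegment L q φ →
             let open Ranking L (preOf φ) (preOf-totalPreorder φ L)
             in size ≡ q × (∀ {u} → u ∈ L → rank u ≡ φ u)
rank-preOf {L} {q} {φ} u₀∈L φ-onto = onto-segment-unique u₀∈L rank-onto φ-onto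
  (λ u∈L v∈L → mk⇔ (≤ᵇ⇒≤ _ _ ∘ rank-reflects u∈L v∈L) (rank-mono u∈L v∈L ∘ ≤⇒≤ᵇ))
  where open Ranking L (preOf φ) (preOf-totalPreorder φ L)

Monotone : Rel → Set
Monotone G = ∀ a a′ b b′ → G a b → G a′ b′ → a ≤ a′ → b ≤ b′

monotone⇒IsOPPF : ∀ {G} → Monotone G → IsOPPF G
monotone⇒IsOPPF mono =
  (λ a b b′ gab gab′ → ≤-antisym (mono a a b b′ gab gab′ ≤-refl) (mono a a b′ b gab′ gab ≤-refl)) , mono

module _ {Cov : Rel} (cov-succ : ∀ a b → Cov a b → b ≡ suc a) where

  -- If b′ < b = a + 1 then x′ ≤ g(b′) ≤ g(a) < x, contradicting x ≤ x′.
  liftℓ-monotone : ∀ {G} → Monotone G → Monotone (liftℓ Cov G)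
  liftℓ-monotone mono x x′ b b′ (a , ga , _ , a⋖b , Gaga , _ , ga<x , _)
                               (a′ , _ , gb′ , a′⋖b′ , _ , Gb′gb′ , _ , x′≤gb′) x≤x′
    with cov-succ a b a⋖b | cov-succ a′ b′ a′⋖b′
  ... | refl | refl = ≮⇒≥ λ { (s≤s b′≤a) → <-irrefl refl
        (<-≤-trans ga<x (≤-trans x≤x′ (≤-trans x′≤gb′ (mono b′ a gb′ ga Gb′gb′ Gaga b′≤a)))) }

  -- If a′ < a then g(a′ + 1) ≤ g(a) ≤ x ≤ x′ < g(a′ + 1).
  liftr-monotone : ∀ {G} → Monotone G → Monotone (liftr Cov G)
  liftr-monotone mono x x′ a a′ (b , ga , _ , a⋖b , Gaga , _ , ga≤x , _)
                               (b′ , _ , gb′ , a′⋖b′ , _ , Gb′gb′ , _ , x′<gb′) x≤x′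
    with cov-succ a b a⋖b | cov-succ a′ b′ a′⋖b′
  ... | refl | refl = ≮⇒≥ λ a′<a → <-irrefl refl
        (<-≤-trans x′<gb′ (≤-trans (mono b′ a gb′ ga Gb′gb′ Gaga a′<a) (≤-trans ga≤x x≤x′)))

  iterℓ-monotone : ∀ {G} → Monotone G → ∀ k → Monotone (iterℓ Cov G k)
  iterℓ-monotone mono zero    = mono
  iterℓ-monotone mono (suc k) = liftℓ-monotone (iterℓ-monotone mono k)

  iterr-monotone : ∀ {G} → Monotone G → ∀ k → Monotone (iterr Cov G k)
  iterr-monotone mono zero    = mono
  iterr-monotone mono (suc k) = liftr-monotone (iterr-monotone mono k)

iter-negsuc+1 : ∀ {Cov G} k {a b} → iter Cov G (-[1+ k ] ℤ.+ ℤ.1ℤ) a b → iterr Cov G k a b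
iter-negsuc+1 zero    p = p
iter-negsuc+1 (suc k) p = p

∈-concatMap-∃⁺ : ∀ {A B : Set} {f : A → List B} {x xs y} → x ∈ xs → y ∈ f x → y ∈ concatMap f xs
∈-concatMap-∃⁺ {f = f} x∈xs y∈fx = ∈-concatMap⁺ f (lose x∈xs y∈fx)

∈-concatMap-∃⁻ : ∀ {A B : Set} (f : A → List B) xs {y} → y ∈ concatMap f xs → ∃ λ x → x ∈ xs × y ∈ f x
∈-concatMap-∃⁻ f xs = find ∘ ∈-concatMap⁻ f {xs = xs}

module Δgen-Blocks (e : ℕ → ℤ) (s : Letter) (s≢var : ∀ {i m} → s ≢ var i m) (i : ℕ) where

  blocks : ℕ → Word → List Word
  blocks b v = block0 e s i b v ++ concatMap (λ j → block e s i j (b ∸ j) v) (map suc (upTo b))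

  private
    pair-head : ∀ {j w i′ m r} → (var i′ m ∷ r) ∈ (var i (e j) ∷ w) ∷ (s ∷ var i (e j) ∷ w) ∷ [] →
                i′ ≡ i × m ≡ e j × r ≡ w
    pair-head (here refl)         = refl , refl , refl
    pair-head (there (here eq))   = contradiction (sym (∷-injectiveˡ eq)) s≢var

  block-head : ∀ {j len v i′ m r} → (var i′ m ∷ r) ∈ block e s i j len v →
               i′ ≡ i × m ≡ e j × (s ∷ var i′ m ∷ r) ∈ block e s i j len v
  block-head {len = zero} z∈ with pair-head z∈
  ... | refl , refl , refl = refl , refl , there (here refl)
  block-head {j} {suc len} {v} z∈ with ∈-concatMap-∃⁻ _ (block e s i (suc j) len v) z∈
  ... | w , w∈ , z∈pair with pair-head z∈pair
  ... | refl , refl , refl = refl , refl , ∈-concatMap-∃⁺ w∈ (there (here refl))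

  block-extend : ∀ {j len v z} → z ∈ block e s i (suc j) len v →
                 (var i (e j) ∷ z) ∈ block e s i j (suc len) v
               × (s ∷ var i (e j) ∷ z) ∈ block e s i j (suc len) v
  block-extend z∈ = ∈-concatMap-∃⁺ z∈ (here refl) , ∈-concatMap-∃⁺ z∈ (there (here refl))

  block0-head : ∀ {b v i′ m r} → (var i′ m ∷ r) ∈ block0 e s i b v → m ≡ e 0
  block0-head {zero} (here refl) = refl
  block0-head {suc b} z∈ with ∈-map⁻ _ z∈
  ... | _ , _ , refl = refl

  block⊆blocks : ∀ {b v t z} → t < b → z ∈ block e s i (suc t) (b ∸ suc t) v → z ∈ blocks b v
  block⊆blocks {b} t<b z∈ = ∈-++⁺ʳ (block0 e s i b _) (∈-concatMap-∃⁺ (∈-map⁺ suc (∈-upTo⁺ t<b)) z∈)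

  blocks-step : ∀ {b v t z} → t < b → z ∈ block e s i (suc t) (b ∸ suc t) v → (var i (e t) ∷ z) ∈ blocks b v
  blocks-step {suc b} {t = zero} _ z∈ = ∈-++⁺ˡ (∈-map⁺ _ z∈)
  blocks-step {b} {v} {suc t} {z} 1+t<b z∈ =
    block⊆blocks (<-trans (n<1+n t) 1+t<b)
      (subst (λ n → (var i (e (suc t)) ∷ z) ∈ block e s i (suc t) n v) (sym (+-∸-assoc 1 1+t<b))
             (proj₁ (block-extend {len = b ∸ suc (suc t)} z∈)))

  blocks-ladder : ∀ {b v i′ m r} → (var i′ m ∷ r) ∈ blocks b v → m ≢ e 0 →
    ∃ λ t → i′ ≡ i × m ≡ e (suc t)
          × (s ∷ var i′ m ∷ r) ∈ blocks b v
          × (var i (e t) ∷ s ∷ var i′ m ∷ r) ∈ blocks b v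
          × (var i (e t) ∷ var i′ m ∷ r) ∈ blocks b v
  blocks-ladder {b} {v} z∈ m≢e0 with ∈-++⁻ (block0 e s i b v) z∈
  ... | inj₁ z∈block0 = contradiction (block0-head {b} z∈block0) m≢e0
  ... | inj₂ z∈blockⱼ with ∈-concatMap-∃⁻ _ (map suc (upTo b)) z∈blockⱼ
  ... | j , j∈ , z∈block with ∈-map⁻ suc j∈
  ... | t , t∈ , refl with block-head {suc t} {b ∸ suc t} z∈block
  ... | refl , refl , sz∈block =
    t , refl , refl , block⊆blocks t<b sz∈block , blocks-step t<b sz∈block , blocks-step t<b z∈block
    where
    t<b : t < b
    t<b = ∈-upTo⁻ t∈

  blocks-top : ∀ {b v} → (var i (e (suc b)) ∷ v) ∈ blocks (suc b) v
  blocks-top {b} {v} = block⊆blocks (n<1+n b)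
    (subst (λ n → (var i (e (suc b)) ∷ v) ∈ block e s i (suc b) n v) (sym (n∸n≡0 b)) (here refl))

module Blocks⁺ = Δgen-Blocks +_   minus (λ ())
module Blocks⁻ = Δgen-Blocks negℕ plus  (λ ())

Δxv-blocks : ℕ → ℤ → Word → List Word
Δxv-blocks i (+ m)      v = Blocks⁺.blocks i m v
Δxv-blocks i -[1+ m ] v = Blocks⁻.blocks i (suc m) v

Δxv-blocks-top : ∀ {i m v} → m ≢ + 0 → (var i m ∷ v) ∈ Δxv-blocks i m v
Δxv-blocks-top {m = + zero}   m≢0 = contradiction refl m≢0
Δxv-blocks-top {m = + suc m}  _   = Blocks⁺.blocks-top _
Δxv-blocks-top {m = -[1+ m ]} _   = Blocks⁻.blocks-top _

Δxv-split : ∀ {i v z} m → z ∈ Δxv i m v → z ≡ v ⊎ z ∈ Δxv-blocks i m v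
Δxv-split (+ _)      (here z≡v) = inj₁ z≡v
Δxv-split (+ _)      (there z∈) = inj₂ z∈
Δxv-split -[1+ _ ] (here z≡v) = inj₁ z≡v
Δxv-split -[1+ _ ] (there z∈) = inj₂ z∈

negsuc+1≡negℕ : ∀ k → -[1+ k ] ℤ.+ ℤ.1ℤ ≡ negℕ k
negsuc+1≡negℕ zero    = refl
negsuc+1≡negℕ (suc k) = refl

∈-tails-tail : ∀ {x v} (w : Word) → (x ∷ v) ∈ tails w → v ∈ tails w
∈-tails-tail (_ ∷ w) (here refl) = there (here refl)
∈-tails-tail (_ ∷ w) (there p)   = there (∈-tails-tail w p)

FS-tail : ∀ {ε x v} → (x ∷ v) ∈ FS ε → v ∈ FS ε
FS-tail {ε} (there p) with ∈-concatMap-∃⁻ _ ε p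
... | w , w∈ε , xv∈tails = there (∈-concatMap-∃⁺ w∈ε (∈-tails-tail (embed w) xv∈tails))

module _ (ε : Equation) where

  -- Membership is taken in FS⁺, the tail of FS ε, so that the local function of the
  -- definition of Δ is recovered by unification (over FS ε itself, concatMap reduces too far).
  private
    FS⁺ : List Word
    FS⁺ = concatMap (λ w → tails (embed w)) ε

  Δ-member⁺ : ∀ {i m v z} → (var i m ∷ v) ∈ FS ε → z ∈ Δxv i m v → z ∈ Δ ε
  Δ-member⁺ (there xv∈FS⁺) z∈Δxv = there (∈-concatMap-∃⁺ {xs = FS⁺} xv∈FS⁺ z∈Δxv)

  Δ-member⁻ : ∀ {z} → z ∈ Δ ε →
              z ≡ [] ⊎ ∃ λ i → ∃ λ m → ∃ λ v → (var i m ∷ v) ∈ FS ε × z ∈ Δxv i m v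
  Δ-member⁻ (here z≡[]) = inj₁ z≡[]
  Δ-member⁻ (there z∈) with ∈-concatMap-∃⁻ _ FS⁺ z∈
  ... | var i m ∷ v , w∈ , z∈Δxv = inj₂ (i , m , v , there w∈ , z∈Δxv)

  Δ-source : ∀ {i m v} → (var i m ∷ v) ∈ Δ ε → m ≢ + 0 →
    ∃ λ i′ → ∃ λ m′ → ∃ λ v′ → (var i′ m′ ∷ v′) ∈ FS ε × (var i m ∷ v) ∈ Δxv-blocks i′ m′ v′
  Δ-source xv∈Δ m≢0 with Δ-member⁻ xv∈Δ
  ... | inj₁ ()
  ... | inj₂ (i′ , m′ , v′ , x′v′∈FS , xv∈) with Δxv-split m′ xv∈
  ... | inj₁ refl = _ , _ , _ , FS-tail {ε} x′v′∈FS , Δxv-blocks-top m≢0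
  ... | inj₂ xv∈blocks = i′ , m′ , v′ , x′v′∈FS , xv∈blocks

  -- The words that (iii ℓ) and (iii r) require to lie in Δ_ε along with x_i^(m) v, where m′ = m ∓ 1.
  Ladder : Letter → ℕ → ℤ → ℤ → Word → Set
  Ladder s i m′ m v = (s ∷ var i m ∷ v) ∈ Δ ε
                    × (var i m′ ∷ s ∷ var i m ∷ v) ∈ Δ ε
                    × (var i m′ ∷ var i m ∷ v) ∈ Δ ε

  Δ-ladderˡ : ∀ {i k v} → (var i (+ suc k) ∷ v) ∈ Δ ε → Ladder minus i (+ k) (+ suc k) v
  Δ-ladderˡ xv∈Δ with Δ-source xv∈Δ (λ ())
  ... | i′ , + M , v′ , w∈ , xv∈ with Blocks⁺.blocks-ladder i′ {M} {v′} xv∈ (λ ())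
  ... | _ , refl , refl , a , b , c = Δ-member⁺ w∈ (there a) , Δ-member⁺ w∈ (there b) , Δ-member⁺ w∈ (there c)
  Δ-ladderˡ xv∈Δ | i′ , -[1+ M ] , v′ , w∈ , xv∈ with Blocks⁻.blocks-ladder i′ {suc M} {v′} xv∈ (λ ())
  ... | _ , refl , () , _

  Δ-ladderʳ : ∀ {i k v} → (var i -[1+ k ] ∷ v) ∈ Δ ε → Ladder plus i (-[1+ k ] ℤ.+ ℤ.1ℤ) -[1+ k ] v
  Δ-ladderʳ {k = k} xv∈Δ rewrite negsuc+1≡negℕ k with Δ-source xv∈Δ (λ ())
  ... | i′ , -[1+ M ] , v′ , w∈ , xv∈ with Blocks⁻.blocks-ladder i′ {suc M} {v′} xv∈ (λ ())
  ... | _ , refl , refl , a , b , c = Δ-member⁺ w∈ (there a) , Δ-member⁺ w∈ (there b) , Δ-member⁺ w∈ (there c)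
  Δ-ladderʳ xv∈Δ | i′ , + M , v′ , w∈ , xv∈ with Blocks⁺.blocks-ladder i′ {M} {v′} xv∈ (λ ())
  ... | _ , refl , () , _

module FromSurjection (ε : Equation) (q : ℕ) (φ : Word → ℕ) (cs : CompatSurj ε q φ) where

  private
    G : ℕ → Rel
    G = gRel ε q φ

    Cov : Rel
    Cov = covRel ε q φ

    g-OPPF : ∀ i → IsOPPF (G i)
    g-OPPF = proj₁ (proj₂ cs)

    cov-succ : ∀ a b → Cov a b → b ≡ suc a
    cov-succ = proj₁ (proj₂ (proj₂ cs))

    iterate : ∀ i m u → u ∈ Δ ε → (var i m ∷ u) ∈ Δ ε → iter Cov (G i) m (φ u) (φ (var i m ∷ u))
    iterate = proj₂ (proj₂ (proj₂ cs))

    iterℓ-functional : ∀ i k {a b b′} → iterℓ Cov (G i) k a b → iterℓ Cov (G i) k a b′ → b ≡ b′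
    iterℓ-functional i k = proj₁ (monotone⇒IsOPPF (iterℓ-monotone cov-succ (proj₂ (g-OPPF i)) k)) _ _ _

    iterr-functional : ∀ i k {a b b′} → iterr Cov (G i) k a b → iterr Cov (G i) k a b′ → b ≡ b′
    iterr-functional i k = proj₁ (monotone⇒IsOPPF (iterr-monotone cov-succ (proj₂ (g-OPPF i)) k)) _ _ _

  -- φ(x^(k+1) v) = φ(−x^(k+1) v) + 1, so the witness a of g^[k+1] is φ(−x^(k+1) v).
  ladderˡ-order : ∀ {i k v} → v ∈ Δ ε → (var i (+ suc k) ∷ v) ∈ Δ ε →
                  φ (var i (+ k) ∷ minus ∷ var i (+ suc k) ∷ v) < φ v × φ v ≤ φ (var i (+ k) ∷ var i (+ suc k) ∷ v)
  ladderˡ-order {i} {k} {v} v∈Δ xv∈Δ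
    with m∈ , km∈ , kx∈ ← Δ-ladderˡ ε xv∈Δ
    with a , ga , gb , a⋖b , Gaga , Gbgb , ga<φv , φv≤gb ← iterate i (+ suc k) v v∈Δ xv∈Δ
    with refl ← suc-injective (trans (sym (cov-succ _ _ a⋖b)) (cov-succ _ _ (inj₂ (_ , xv∈Δ , m∈ , refl , refl))))
    = subst (_< φ v) (iterℓ-functional i k Gaga (iterate i (+ k) _ m∈ km∈)) ga<φv ,
      subst (φ v ≤_) (iterℓ-functional i k Gbgb (iterate i (+ k) _ xv∈Δ kx∈)) φv≤gb

  ladderʳ-order : ∀ {i k v} → v ∈ Δ ε → (var i -[1+ k ] ∷ v) ∈ Δ ε →
                  let j+1 = -[1+ k ] ℤ.+ ℤ.1ℤ in
                  φ (var i j+1 ∷ var i -[1+ k ] ∷ v) ≤ φ v × φ v < φ (var i j+1 ∷ plus ∷ var i -[1+ k ] ∷ v)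
  ladderʳ-order {i} {k} {v} v∈Δ xv∈Δ
    with p∈ , ep∈ , ex∈ ← Δ-ladderʳ ε xv∈Δ
    with b , ga , gb , a⋖b , Gaga , Gbgb , ga≤φv , φv<gb ← iterate i -[1+ k ] v v∈Δ xv∈Δ
    with refl ← trans (cov-succ _ _ a⋖b) (sym (cov-succ _ _ (inj₁ (_ , xv∈Δ , p∈ , refl , refl))))
    = subst (_≤ φ v) (iterr-functional i k Gaga (iter-negsuc+1 k (iterate i _ _ xv∈Δ ex∈))) ga≤φv ,
      subst (φ v <_) (iterr-functional i k Gbgb (iter-negsuc+1 k (iterate i _ _ p∈ ep∈))) φv<gb

  compatPre : CompatPre ε (preOf φ)
  compatPre =
    preOf-totalPreorder φ (Δ ε) ,
    (λ i u v u∈ v∈ xu∈ xv∈ u⊴v → ≤⇒≤ᵇ (proj₂ (g-OPPF i) _ _ _ _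
                                        (u , u∈ , xu∈ , refl , refl) (v , v∈ , xv∈ , refl , refl) (≤ᵇ⇒≤ _ _ u⊴v))) ,
    (λ u u∈ mu∈ → cover (cov-succ _ _ (inj₂ (u , u∈ , mu∈ , refl , refl)))) ,
    (λ u u∈ pu∈ → cover (cov-succ _ _ (inj₁ (u , u∈ , pu∈ , refl , refl)))) ,
    (λ { i (+ suc k) v (ℤ.+<+ _) v∈ xv∈ →
           let m∈ , km∈ , kx∈ = Δ-ladderˡ ε xv∈
               lt , le = ladderˡ-order v∈ xv∈
           in m∈ , km∈ , kx∈ , <⇒preOf-strict φ lt , ≤⇒≤ᵇ le }) ,
    (λ { i -[1+ k ] v ℤ.-<+ v∈ xv∈ →
           let p∈ , ep∈ , ex∈ = Δ-ladderʳ ε xv∈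
               le , lt = ladderʳ-order v∈ xv∈
           in p∈ , ep∈ , ex∈ , ≤⇒≤ᵇ le , <⇒preOf-strict φ lt })
    where
    cover : ∀ {a b} → φ b ≡ suc (φ a) →
            _◁_ ε (preOf φ) a b × (∀ v → v ∈ Δ ε → _◁_ ε (preOf φ) a v → _⊴_ ε (preOf φ) b v)
    cover φb≡ = Product.map₂ (λ least v _ → least v) (suc⇒preOf-cover φ φb≡)

module FromPreorder (ε : Equation) (R : Word → Word → Bool) (cp : CompatPre ε R) where

  open Ranking (Δ ε) R (proj₁ cp)

  private
    G : ℕ → Rel
    G = gRel ε size rank

    Cov : Rel
    Cov = covRel ε size rank

    _≼_ _≺_ : Word → Word → Set
    _≼_ = _⊴_ ε R
    _≺_ = _◁_ ε R

    ≼-mono : ∀ i u v → u ∈ Δ ε → v ∈ Δ ε → (var i (+ 0) ∷ u) ∈ Δ ε → (var i (+ 0) ∷ v) ∈ Δ ε →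
             u ≼ v → (var i (+ 0) ∷ u) ≼ (var i (+ 0) ∷ v)
    ≼-mono = proj₁ (proj₂ cp)

    minus-cover : ∀ u → u ∈ Δ ε → (minus ∷ u) ∈ Δ ε →
                  (minus ∷ u) ≺ u × (∀ v → v ∈ Δ ε → (minus ∷ u) ≺ v → u ≼ v)
    minus-cover = proj₁ (proj₂ (proj₂ cp))

    plus-cover : ∀ u → u ∈ Δ ε → (plus ∷ u) ∈ Δ ε →
                 u ≺ (plus ∷ u) × (∀ v → v ∈ Δ ε → u ≺ v → (plus ∷ u) ≼ v)
    plus-cover = proj₁ (proj₂ (proj₂ (proj₂ cp)))

    ladderˡ-order : ∀ i k {v} → v ∈ Δ ε → (var i (+ suc k) ∷ v) ∈ Δ ε →
                    (var i (+ k) ∷ minus ∷ var i (+ suc k) ∷ v) ≺ v × v ≼ (var i (+ k) ∷ var i (+ suc k) ∷ v)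
    ladderˡ-order i k {v} v∈ xv∈ =
      proj₂ (proj₂ (proj₂ (proj₁ (proj₂ (proj₂ (proj₂ (proj₂ cp)))) i (+ suc k) v (ℤ.+<+ (s≤s z≤n)) v∈ xv∈)))

    ladderʳ-order : ∀ i k {v} → v ∈ Δ ε → (var i -[1+ k ] ∷ v) ∈ Δ ε →
                    let j+1 = -[1+ k ] ℤ.+ ℤ.1ℤ in
                    (var i j+1 ∷ var i -[1+ k ] ∷ v) ≼ v × v ≺ (var i j+1 ∷ plus ∷ var i -[1+ k ] ∷ v)
    ladderʳ-order i k {v} v∈ xv∈ =
      proj₂ (proj₂ (proj₂ (proj₂ (proj₂ (proj₂ (proj₂ (proj₂ cp)))) i -[1+ k ] v ℤ.-<+ v∈ xv∈)))

  g-monotone : ∀ i → Monotone (G i)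
  g-monotone i _ _ _ _ (u , u∈ , xu∈ , refl , refl) (v , v∈ , xv∈ , refl , refl) ru≤rv =
    rank-mono xu∈ xv∈ (≼-mono i u v u∈ v∈ xu∈ xv∈ (rank-reflects u∈ v∈ ru≤rv))

  cov-succ : ∀ a b → Cov a b → b ≡ suc a
  cov-succ _ _ (inj₁ (v , v∈ , pv∈ , refl , refl)) =
    let (v≺pv , least) = plus-cover v v∈ pv∈ in rank-succ v∈ pv∈ v≺pv least
  cov-succ _ _ (inj₂ (v , v∈ , mv∈ , refl , refl)) =
    let (mv≺v , least) = minus-cover v v∈ mv∈ in rank-succ mv∈ v∈ mv≺v least

  iterate-zero : ∀ i {u} → u ∈ Δ ε → (var i (+ 0) ∷ u) ∈ Δ ε → G i (rank u) (rank (var i (+ 0) ∷ u))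
  iterate-zero i {u} u∈ xu∈ = u , u∈ , xu∈ , refl , refl

  iterateˡ : ∀ i k {u} → u ∈ Δ ε → (var i (+ k) ∷ u) ∈ Δ ε → iterℓ Cov (G i) k (rank u) (rank (var i (+ k) ∷ u))
  iterateˡ i zero    = iterate-zero i
  iterateˡ i (suc k) u∈ xu∈
    with m∈ , km∈ , kx∈ ← Δ-ladderˡ ε xu∈
    with (_ , u⋬kmxu) , u≼kxu ← ladderˡ-order i k u∈ xu∈ =
    _ , _ , _ , inj₂ (_ , xu∈ , m∈ , refl , refl) , iterateˡ i k m∈ km∈ , iterateˡ i k xu∈ kx∈ ,
    rank-< u∈ km∈ u⋬kmxu , rank-mono u∈ kx∈ u≼kxu

  private
    liftr-step : ∀ i k {u} → u ∈ Δ ε → (var i -[1+ k ] ∷ u) ∈ Δ ε →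
      (let e = -[1+ k ] ℤ.+ ℤ.1ℤ in
       ∀ {w} → w ∈ Δ ε → (var i e ∷ w) ∈ Δ ε → iterr Cov (G i) k (rank w) (rank (var i e ∷ w))) →
      iterr Cov (G i) (suc k) (rank u) (rank (var i -[1+ k ] ∷ u))
    liftr-step i k u∈ xu∈ inner
      with p∈ , ep∈ , ex∈ ← Δ-ladderʳ ε xu∈
      with exu≼u , (_ , epxu⋬u) ← ladderʳ-order i k u∈ xu∈ =
      _ , _ , _ , inj₁ (_ , xu∈ , p∈ , refl , refl) , inner xu∈ ex∈ , inner p∈ ep∈ ,
      rank-mono ex∈ u∈ exu≼u , rank-< ep∈ u∈ epxu⋬u

  iterateʳ : ∀ i k {u} → u ∈ Δ ε → (var i -[1+ k ] ∷ u) ∈ Δ ε →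
             iterr Cov (G i) (suc k) (rank u) (rank (var i -[1+ k ] ∷ u))
  iterateʳ i zero    u∈ xu∈ = liftr-step i zero    u∈ xu∈ (iterate-zero i)
  iterateʳ i (suc k) u∈ xu∈ = liftr-step i (suc k) u∈ xu∈ (iterateʳ i k)

  compatSurj : CompatSurj ε (qOf ε R) (φOf ε R)
  compatSurj = rank-onto , (λ i → monotone⇒IsOPPF (g-monotone i)) , cov-succ , iterate
    where
    iterate : ∀ i m u → u ∈ Δ ε → (var i m ∷ u) ∈ Δ ε → iter Cov (G i) m (rank u) (rank (var i m ∷ u))
    iterate i (+ k)      _ = iterateˡ i k
    iterate i -[1+ k ] _ = iterateʳ i k

theorem5p1 : (ε : Equation) →
    ((q : ℕ) (φ : Word → ℕ) → CompatSurj ε q φ → CompatPre ε (preOf φ))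
  × ((R : Word → Word → Bool) → CompatPre ε R → CompatSurj ε (qOf ε R) (φOf ε R))
  × ((q : ℕ) (φ : Word → ℕ) → CompatSurj ε q φ →
       qOf ε (preOf φ) ≡ q × (∀ u → u ∈ Δ ε → φOf ε (preOf φ) u ≡ φ u))
  × ((R : Word → Word → Bool) → CompatPre ε R →
       ∀ u v → u ∈ Δ ε → v ∈ Δ ε → preOf (φOf ε R) u v ≡ R u v)
theorem5p1 ε =
  FromSurjection.compatPre ε ,
  FromPreorder.compatSurj ε ,
  (λ q φ cs → let (size≡q , rank≡φ) = rank-preOf (here refl) (proj₁ cs) in size≡q , λ _ → rank≡φ) ,
  (λ R cp _ _ → Ranking.preOf-rank (Δ ε) R (proj₁ cp))
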